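{- Let $n\ge 1$ and $\sigma=\sigma_1\sigma_2\cdots\sigma_n\in S_n$. Suppose that the inversion code of $\sigma$ is $I(\sigma)=(t_1,t_2,\ldots,t_n)$ and the cyclic major code of $\sigma$ is $M(\sigma)=(s_1,s_2,\ldots,s_n)$. Then $s_n=t_n$, and for $1\le i<n$, \[ s_i=\begin{cases} t_i-t_{i+1}, & \text{if } t_i\ge t_{i+1},\\ t_i-t_{i+1}+i, & \text{if } t_i<t_{i+1},\end{cases}\] i.e. $s_i\equiv t_i-t_{i+1} \pmod i$ with $0\le s_i\le i-1$.
   Context: $S_n$ is the set of permutations of $[n]=\{1,\ldots,n\}$, written in one-line notation $\sigma=\sigma_1\cdots\sigma_n$. For $x\in[n]$ and $y\in[n]$, the cyclic interval $\rrbracket x,y\rrbracket$ is $\{z\in[n]: x<z\le y\}$ if $x\le y$, and $\{z\in[n]: z>x \text{ or } z\le y\}$ if $x>y$; also $\rrbracket x,\infty\rrbracket=\{z\in[n]: z>x\}$. For $\sigma\in S_n$ and $1\le i\le n$, put $t_i(\sigma)=\#\{j: 1\le j\le i-1,\ \sigma_j\in\rrbracket \sigma_i,\infty\rrbracket\}$ and $s_i(\sigma)=\#\{j: 1\le j\le i-1,\ \sigma_j\in\rrbracket \sigma_i,\sigma_{i+1}\rrbracket\}$, with the convention $\sigma_{n+1}=\infty$. The inversion (Lehmer) code is $I(\sigma)=(t_1(\sigma),\ldots,t_n(\sigma))$ and the cyclic major code is $M(\sigma)=(s_1(\sigma),\ldots,s_n(\sigma))$. -}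

module Defs where

open import Data.Nat using (ℕ; zero; suc; _+_; _<_; _≤_; _<?_; _≤?_; _≟_)
open import Data.Fin using (Fin; toℕ; fromℕ<)
open import Data.Fin.Permutation using (Permutation′; _⟨$⟩ʳ_)
open import Data.Bool using (Bool; true; false; _∧_; _∨_; if_then_else_)
open import Data.Maybe using (Maybe; just; nothing)
open import Relation.Nullary.Decidable using (⌊_⌋; yes; no)

-- Permutations of [n] are bijections Fin n ↔ Fin n; position i ∈ [n] (1-indexed)
-- and value σ_i ∈ [n] (1-indexed) are obtained by shifting Fin by one.
-- σ_i for i ∈ ℕ; meaningful only for 1 ≤ i ≤ n (0 otherwise, never used there).
val : {n : ℕ} → Permutation′ n → ℕ → ℕ
val σ zero = 0
val {n} σ (suc k) with k <? n
... | yes p = suc (toℕ (σ ⟨$⟩ʳ fromℕ< p))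
... | no _ = 0

-- σ_{i+1}, with the convention σ_{n+1} = ∞ (represented by nothing).
nextVal : {n : ℕ} → Permutation′ n → ℕ → Maybe ℕ
nextVal {n} σ i = if ⌊ i <? n ⌋ then just (val σ (suc i)) else nothing

-- membership of z in the cyclic interval ]]x,y]] (y = nothing means ∞).
inCyc : ℕ → Maybe ℕ → ℕ → Bool
inCyc x nothing  z = ⌊ x <? z ⌋
inCyc x (just y) z =
  if ⌊ x ≤? y ⌋ then ⌊ x <? z ⌋ ∧ ⌊ z ≤? y ⌋
                else ⌊ x <? z ⌋ ∨ ⌊ z ≤? y ⌋

countUpTo : (ℕ → Bool) → ℕ → ℕ
countUpTo P zero = 0
countUpTo P (suc k) = (if P (suc k) then 1 else 0) + countUpTo P k

tcode : {n : ℕ} → Permutation′ n → ℕ → ℕ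
tcode σ i = countUpTo (λ j → inCyc (val σ i) nothing (val σ j)) (Data.Nat._∸_ i 1)

scode : {n : ℕ} → Permutation′ n → ℕ → ℕ
scode σ i = countUpTo (λ j → inCyc (val σ i) (nextVal σ i) (val σ j)) (Data.Nat._∸_ i 1)

-- Fix i = m + 1 < n and put a = σ_i ≠ b = σ_{i+1}.  With A(c) = #{j ≤ m : σ_j > c} we have t_i = A(a) and t_{i+1} = [a > b] + A(b).
-- If a < b, the interval ]]a,b]] is ]]a,∞]] minus ]]b,∞]], so s_i = A(a) − A(b) = t_i − t_{i+1}
-- and this is ≥ 0.  If a > b, ]]a,b]] wraps around and is ]]a,∞]] plus [1,b], so
-- s_i = A(a) + (m − A(b)) = t_i − t_{i+1} + i, while A(a) ≤ A(b) forces t_i < t_{i+1}.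
-- For i = n the bound σ_{n+1} = ∞ makes s_n and t_n count the same set.
module Submission where

open import Defs
open import Data.Nat using (ℕ; zero; suc; _<_; _≤_; _+_; _∸_; z≤n; _<?_; _≤?_)
open import Data.Nat.Properties
open import Algebra.Properties.CommutativeSemigroup +-commutativeSemigroup using (interchange)
open import Data.Integer using (+_; _-_)
import Data.Integer as ℤ
import Data.Integer.Properties as ℤ
import Data.Integer.Solver as ℤ-Solver
open import Data.Bool using (Bool; true; if_then_else_)
open import Data.Maybe using (just; nothing)
open import Data.Fin using (toℕ; fromℕ<)
open import Data.Fin.Properties using (toℕ-injective; fromℕ<-injective)
open import Data.Fin.Permutation using (Permutation′; _⟨$⟩ʳ_)
open import Data.Product using (_×_; _,_)
open import Function.Bundles using (Injection)
open import Function.Properties.Inverse using (↔⇒↣)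
open import Relation.Binary.Definitions using (tri<; tri≈; tri>)
open import Relation.Binary.PropositionalEquality
  using (_≡_; _≢_; refl; sym; trans; cong; cong₂; module ≡-Reasoning)
open import Relation.Nullary using (yes; no; contradiction)
open import Relation.Nullary.Decidable using (⌊_⌋)

open ≡-Reasoning

indicator : Bool → ℕ
indicator b = if b then 1 else 0

countUpTo-true : ∀ k → countUpTo (λ _ → true) k ≡ k
countUpTo-true zero    = refl
countUpTo-true (suc k) = cong suc (countUpTo-true k)

countUpTo-+ : ∀ {P Q R : ℕ → Bool} →
  (∀ j → indicator (P j) + indicator (Q j) ≡ indicator (R j)) →
  ∀ k → countUpTo P k + countUpTo Q k ≡ countUpTo R k
countUpTo-+ h zero = refl
countUpTo-+ {P} {Q} h (suc k) = begin
  indicator (P (suc k)) + countUpTo P k + (indicator (Q (suc k)) + countUpTo Q k)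
    ≡⟨ interchange (indicator (P (suc k))) (countUpTo P k) _ _ ⟩
  indicator (P (suc k)) + indicator (Q (suc k)) + (countUpTo P k + countUpTo Q k)
    ≡⟨ cong₂ _+_ (h (suc k)) (countUpTo-+ h k) ⟩
  _ ∎

countUpTo-mono : ∀ {P Q : ℕ → Bool} →
  (∀ j → indicator (P j) ≤ indicator (Q j)) → ∀ k → countUpTo P k ≤ countUpTo Q k
countUpTo-mono h zero    = z≤n
countUpTo-mono h (suc k) = +-mono-≤ (h (suc k)) (countUpTo-mono h k)

inCyc-ascending : ∀ {a b} x → a < b →
  indicator (inCyc a (just b) x) + indicator ⌊ b <? x ⌋ ≡ indicator ⌊ a <? x ⌋
inCyc-ascending {a} {b} x a<b with a ≤? b
... | no a≰b = contradiction (<⇒≤ a<b) a≰b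
... | yes _ with a <? x | x ≤? b | b <? x
... | _      | yes x≤b | yes b<x = contradiction x≤b (<⇒≱ b<x)
... | _      | no x≰b  | no b≮x  = contradiction (≰⇒> x≰b) b≮x
... | no a≮x | no _    | yes b<x = contradiction (<-trans a<b b<x) a≮x
... | yes _  | yes _   | no _    = refl
... | yes _  | no _    | yes _   = refl
... | no _   | yes _   | no _    = refl

inCyc-wrapping : ∀ {a b} x → b < a →
  indicator (inCyc a (just b) x) ≡ indicator ⌊ a <? x ⌋ + indicator ⌊ x ≤? b ⌋
inCyc-wrapping {a} {b} x b<a with a ≤? b
... | yes a≤b = contradiction a≤b (<⇒≱ b<a)
... | no _ with a <? x | x ≤? b
... | yes a<x | yes x≤b = contradiction (<-trans (≤-<-trans x≤b b<a) a<x) (<-irrefl refl)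
... | yes _   | no _    = refl
... | no _    | yes _   = refl
... | no _    | no _    = refl

indicator-≤-+-> : ∀ x b → indicator ⌊ x ≤? b ⌋ + indicator ⌊ b <? x ⌋ ≡ 1
indicator-≤-+-> x b with x ≤? b | b <? x
... | yes x≤b | yes b<x = contradiction x≤b (<⇒≱ b<x)
... | yes _   | no _    = refl
... | no _    | yes _   = refl
... | no x≰b  | no b≮x  = contradiction (≰⇒> x≰b) b≮x

indicator-<-antitone : ∀ {a b} x → b < a → indicator ⌊ a <? x ⌋ ≤ indicator ⌊ b <? x ⌋
indicator-<-antitone {a} {b} x b<a with a <? x | b <? x
... | yes a<x | no b≮x = contradiction (<-trans b<a a<x) b≮x
... | yes _   | yes _  = ≤-refl
... | no _    | _      = z≤n

countAbove : (ℕ → ℕ) → ℕ → ℕ → ℕ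
countAbove f m c = countUpTo (λ j → ⌊ c <? f j ⌋) m

countCyclic : (ℕ → ℕ) → ℕ → ℕ → ℕ → ℕ
countCyclic f m a b = countUpTo (λ j → inCyc a (just b) (f j)) m

countCyclic-ascending : ∀ f m {a b} → a < b →
  countCyclic f m a b + countAbove f m b ≡ countAbove f m a
countCyclic-ascending f m a<b = countUpTo-+ (λ j → inCyc-ascending (f j) a<b) m

countAbove-antitone : ∀ f m {a b} → b < a → countAbove f m a ≤ countAbove f m b
countAbove-antitone f m b<a = countUpTo-mono (λ j → indicator-<-antitone (f j) b<a) m

countCyclic-wrapping : ∀ f m {a b} → b < a →
  countCyclic f m a b + suc (countAbove f m b) ≡ countAbove f m a + suc m
countCyclic-wrapping f m {a} {b} b<a = begin
  countCyclic f m a b + suc (countAbove f m b)   ≡⟨ cong (_+ suc (countAbove f m b)) cyclic≡above-a+atMost-b ⟩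
  countAbove f m a + atMost-b + suc (countAbove f m b)
    ≡⟨ +-assoc (countAbove f m a) atMost-b _ ⟩
  countAbove f m a + (atMost-b + suc (countAbove f m b))
    ≡⟨ cong (λ x → countAbove f m a + x) (trans (+-suc atMost-b _) (cong suc atMost-b+above-b)) ⟩
  countAbove f m a + suc m ∎
  where
  atMost-b : ℕ
  atMost-b = countUpTo (λ j → ⌊ f j ≤? b ⌋) m

  cyclic≡above-a+atMost-b : countCyclic f m a b ≡ countAbove f m a + atMost-b
  cyclic≡above-a+atMost-b = sym (countUpTo-+ (λ j → sym (inCyc-wrapping (f j) b<a)) m)

  atMost-b+above-b : atMost-b + countAbove f m b ≡ m
  atMost-b+above-b = trans (countUpTo-+ (λ j → indicator-≤-+-> (f j) b) m) (countUpTo-true m)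

+-≡-sub-+ : ∀ s t t′ i → s + t′ ≡ t + i → + s ≡ (+ t - + t′) ℤ.+ + i
+-≡-sub-+ s t t′ i s+t′≡t+i = begin
  + s                        ≡⟨ add-sub (+ s) (+ t′) ⟩
  (+ s ℤ.+ + t′) - + t′      ≡⟨ cong (_- + t′) (begin
    + s ℤ.+ + t′               ≡⟨ ℤ.pos-+ s t′ ⟨
    + (s + t′)                 ≡⟨ cong +_ s+t′≡t+i ⟩
    + (t + i)                  ≡⟨ ℤ.pos-+ t i ⟩
    + t ℤ.+ + i                ∎) ⟩
  (+ t ℤ.+ + i) - + t′       ≡⟨ add-sub-comm (+ t) (+ i) (+ t′) ⟩
  (+ t - + t′) ℤ.+ + i       ∎
  where
  open ℤ-Solver.+-*-Solver
  add-sub : ∀ x y → x ≡ (x ℤ.+ y) - y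
  add-sub = solve 2 (λ x y → x := (x :+ y) :- y) refl
  add-sub-comm : ∀ x y z → (x ℤ.+ y) - z ≡ (x - z) ℤ.+ y
  add-sub-comm = solve 3 (λ x y z → (x :+ y) :- z := (x :- z) :+ y) refl

-- With f = val σ and b = σ_{i+1}, this is the case i = m + 1 < n of the proposition.
cyclicCount-formula : ∀ f m b → f (suc m) ≢ b →
  (countAbove f (suc m) b ≤ countAbove f m (f (suc m)) →
     countCyclic f m (f (suc m)) b ≡ countAbove f m (f (suc m)) ∸ countAbove f (suc m) b) ×
  (countAbove f m (f (suc m)) < countAbove f (suc m) b →
     + countCyclic f m (f (suc m)) b ≡
       (+ countAbove f m (f (suc m)) - + countAbove f (suc m) b) ℤ.+ + suc m)
cyclicCount-formula f m b a≢b with <-cmp (f (suc m)) b | b <? f (suc m)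
... | tri≈ _ a≡b _ | _       = contradiction a≡b a≢b
... | tri< a<b _ _ | yes b<a = contradiction b<a (<⇒≯ a<b)
... | tri> _ _ b<a | no b≮a  = contradiction b<a b≮a
... | tri< a<b _ _ | no _    = (λ _ → s≡t∸tb) , (λ t<tb → contradiction tb≤t (<⇒≱ t<tb))
  where
  s = countCyclic f m (f (suc m)) b
  tb = countAbove f m b

  ascending : s + tb ≡ countAbove f m (f (suc m))
  ascending = countCyclic-ascending f m a<b

  s≡t∸tb : s ≡ countAbove f m (f (suc m)) ∸ tb
  s≡t∸tb = trans (sym (m+n∸n≡m s tb)) (cong (_∸ tb) ascending)

  tb≤t : tb ≤ countAbove f m (f (suc m))
  tb≤t = ≤-trans (m≤n+m tb s) (≤-reflexive ascending)
... | tri> _ _ b<a | yes _   =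
  (λ 1+tb≤t → contradiction (≤-trans 1+tb≤t (countAbove-antitone f m b<a)) 1+n≰n)
  , (λ _ → +-≡-sub-+ (countCyclic f m (f (suc m)) b) (countAbove f m (f (suc m)))
                     (suc (countAbove f m b)) (suc m) (countCyclic-wrapping f m b<a))

val-suc : ∀ {n} (σ : Permutation′ n) {k} (k<n : k < n) →
  val σ (suc k) ≡ suc (toℕ (σ ⟨$⟩ʳ fromℕ< k<n))
val-suc {n} σ {k} k<n with k <? n
... | yes _  = refl
... | no k≮n = contradiction k<n k≮n

val-injective : ∀ {n} (σ : Permutation′ n) {j k} (j<n : j < n) (k<n : k < n) →
  val σ (suc j) ≡ val σ (suc k) → j ≡ k
val-injective σ {j} {k} j<n k<n eq =
  fromℕ<-injective j k j<n k<n (Injection.injective (↔⇒↣ σ)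
    (toℕ-injective (suc-injective (trans (sym (val-suc σ j<n)) (trans eq (val-suc σ k<n))))))

nextVal-last : ∀ {n} (σ : Permutation′ n) → nextVal σ n ≡ nothing
nextVal-last {n} σ with n <? n
... | yes n<n = contradiction n<n (<-irrefl refl)
... | no _    = refl

nextVal-inside : ∀ {n} (σ : Permutation′ n) {i} → i < n → nextVal σ i ≡ just (val σ (suc i))
nextVal-inside {n} σ {i} i<n with i <? n
... | yes _  = refl
... | no i≮n = contradiction i<n i≮n

proposition2p1 : (n : ℕ) → 1 ≤ n → (σ : Permutation′ n) →
    (scode σ n ≡ tcode σ n) ×
    ((i : ℕ) → 1 ≤ i → i < n →
      (tcode σ (i + 1) ≤ tcode σ i → scode σ i ≡ tcode σ i ∸ tcode σ (i + 1)) ×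
      (tcode σ i < tcode σ (i + 1) →
        + scode σ i ≡ (+ tcode σ i - + tcode σ (i + 1)) Data.Integer.+ + i))
proposition2p1 n _ σ = last , inner
  where
  last : scode σ n ≡ tcode σ n
  last rewrite nextVal-last σ = refl

  inner : (i : ℕ) → 1 ≤ i → i < n →
      (tcode σ (i + 1) ≤ tcode σ i → scode σ i ≡ tcode σ i ∸ tcode σ (i + 1)) ×
      (tcode σ i < tcode σ (i + 1) →
        + scode σ i ≡ (+ tcode σ i - + tcode σ (i + 1)) Data.Integer.+ + i)
  inner (suc m) _ i<n rewrite +-comm m 1 | nextVal-inside σ i<n =
    cyclicCount-formula (val σ) m (val σ (suc (suc m)))
      (λ eq → 1+n≢n (sym (val-injective σ (<-trans (n<1+n m) i<n) i<n eq)))
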